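{- Let $T$ be a plane labelled bipartite tree with $n$ white and $m$ black vertices, where $n+m$ is even, and fix a white root vertex $v_i$. Then the invariant $i(T)$ computed with root vertex $v_i$ does not depend on the choice of the root edge $e$ incident to $v_i$.
   Context: A plane labelled bipartite tree has white vertices labelled $v_1,\dots,v_n$ and black vertices labelled $u_1,\dots,u_m$ (distinct labels), adjacent vertices having different colours, embedded in the plane. Choose a white root vertex $v_i$ and a root edge $e$ incident to $v_i$. Traverse the boundary of $T$ counterclockwise starting at $v_i$, keeping $e$ to the left; during this walk write the label of a vertex when it is met for the first time, and write a closing bracket ")" when a vertex is met for the last time. This produces a string $c(T)$ of $n+m$ labels and $n+m$ closing brackets. Define: $a$ = number of pairs of white labels $v_k,v_l$ with $v_k$ before $v_l$ in $c(T)$ and $k>l$; $b$ = the analogous number of inversions among black labels $u$; $c$ = number of pairs (black label $u$, white label $v$) with $u$ before $v$ in $c(T)$; $d$ = number of pairs (closing bracket, label) with the bracket before the label in $c(T)$; $e=|n-m|/2$. The invariant is $i(T)\equiv a+b+c+\frac{d+e}{2} \pmod 2$, $i(T)\in\{0,1\}$. -}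

module Defs where

open import Data.Nat.Base using (ℕ; zero; suc; _+_; _<ᵇ_; ∣_-_∣)
open import Data.Nat.DivMod using (_/_; _%_)
open import Data.Bool.Base using (Bool; true; false; _∧_)
open import Data.List.Base using (List; []; _∷_; _++_; [_]; filter; length; take; drop; mapMaybe)
open import Data.Maybe.Base using (Maybe; just; nothing)
open import Relation.Nullary.Decidable.Core using (T?)

data Colour : Set where
  white black : Colour

flip : Colour → Colour
flip white = black
flip black = white

-- A plane tree, rooted at a vertex with a chosen root edge: each vertex
-- carries its label and the ordered list of its children, listed in the
-- order in which the counterclockwise boundary walk visits them (for the
-- root, the first child is the endpoint of the root edge e).
-- Colours alternate with depth; the root is white.  Labels are natural
-- numbers (label k stands for v_{k+1} resp. u_{k+1}).
data Tree : Set where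
  node : ℕ → List Tree → Tree

data Sym : Set where
  wlab  : ℕ → Sym
  blab  : ℕ → Sym
  close : Sym

lab : Colour → ℕ → Sym
lab white k = wlab k
lab black k = blab k

mutual
  -- boundary walk: label at first visit, ")" at last visit
  code : Colour → Tree → List Sym
  code c (node k ts) = lab c k ∷ (codes (flip c) ts ++ [ close ])

  codes : Colour → List Tree → List Sym
  codes c []       = []
  codes c (t ∷ ts) = code c t ++ codes c ts

cT : Tree → List Sym
cT t = code white t

whiteLabels : List Sym → List ℕ
whiteLabels = mapMaybe f
  where f : Sym → Maybe ℕ
        f (wlab k) = just k
        f _        = nothing

blackLabels : List Sym → List ℕ
blackLabels = mapMaybe f
  where f : Sym → Maybe ℕ
        f (blab k) = just k
        f _        = nothing

pairCount : {A : Set} → (A → A → Bool) → List A → ℕ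
pairCount p []       = 0
pairCount p (x ∷ xs) = length (filter (λ y → T? (p x y)) xs) + pairCount p xs

inversions : List ℕ → ℕ
inversions = pairCount (λ k l → l <ᵇ k)

isBW : Sym → Sym → Bool
isBW (blab _) (wlab _) = true
isBW _        _        = false

isCL : Sym → Sym → Bool
isCL close (wlab _) = true
isCL close (blab _) = true
isCL _     _        = false

invariant : ℕ → ℕ → Tree → ℕ
invariant n m t =
  let w = cT t
      a = inversions (whiteLabels w)
      b = inversions (blackLabels w)
      c = pairCount isBW w
      d = pairCount isCL w
      e = ∣ n - m ∣ / 2
  in (a + b + c + (d + e) / 2) % 2

-- choosing another root edge at the root = cyclic rotation of the root's children
rotate : {A : Set} → ℕ → List A → List A
rotate k xs = drop k xs ++ take k xs

rotateRoot : ℕ → Tree → Tree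
rotateRoot k (node r ts) = node r (rotate k ts)

-- Rotating the root edge cyclically permutes the subtrees of the root, so it suffices to
-- swap two adjacent blocks X, Y of the code word.  The number d of (bracket, label) pairs
-- is unchanged because each block has as many brackets as labels.  The quantity a + b + c
-- changes by the difference of the numbers of its pairs running from X to Y and from Y to
-- X; as all labels are distinct, every (label of X, label of Y) pair is counted exactly
-- once in their sum, which is therefore |X| |Y| (|X| = number of labels in X).  Since
-- |X| + |Y| = n + m - 1 is odd, |X| |Y| is even, so a + b + c keeps its parity.
module Submission where

open import Defs
open import Data.Bool.Base using (Bool; true; false; _∧_; not; T)
open import Data.Empty using (⊥-elim)
open import Data.List.Base using (List; []; _∷_; _++_; [_]; filter; length; upTo; take; drop)
open import Data.List.Properties using (filter-++; length-++; ++-assoc; ++-identityʳ; mapMaybe-++; length-upTo; take++drop≡id)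
open import Data.List.Relation.Unary.All as All using (All; []; _∷_)
open import Data.List.Relation.Unary.All.Properties using (++⁻ʳ)
open import Data.List.Relation.Unary.AllPairs using (AllPairs; []; _∷_)
open import Data.List.Relation.Unary.Unique.Propositional using (Unique)
open import Data.List.Relation.Unary.Unique.Propositional.Properties using (upTo⁺)
open import Data.List.Relation.Binary.Permutation.Propositional using (_↭_; ↭-sym; ↭⇒↭ₛ)
open import Data.List.Relation.Binary.Permutation.Propositional.Properties using (↭-length)
import Data.List.Relation.Binary.Permutation.Setoid.Properties as PermutationSetoid
open import Data.Nat.Base using (ℕ; zero; suc; _+_; _*_; _<ᵇ_; ∣_-_∣)
open import Data.Nat.DivMod using (_/_; _%_; [m+kn]%n≡m%n)
open import Data.Nat.Divisibility using (_∣_; divides; ∣m+n∣m⇒∣n; ∣m⇒∣m*n; ∣n⇒∣m*n)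
open import Data.Nat.Properties
open import Algebra.Properties.CommutativeSemigroup +-commutativeSemigroup using (x∙yz≈y∙xz; interchange)
open import Data.Nat.Solver using (module +-*-Solver)
open import Data.Sum using (_⊎_; inj₁; inj₂)
open import Function.Base using (_∘_)
open import Relation.Binary.PropositionalEquality hiding ([_])
open import Relation.Nullary.Decidable.Core using (T?)

open +-*-Solver using (solve; _:+_; _:*_; _:=_; con)

private
  variable
    A : Set

-- Defined like the inner count of pairCount, so that pairCount p (x ∷ xs) unfolds to count (p x) xs + pairCount p xs.
count : (A → Bool) → List A → ℕ
count q xs = length (filter (λ y → T? (q y)) xs)

crossCount : (A → A → Bool) → List A → List A → ℕ
crossCount p []       ys = 0
crossCount p (x ∷ xs) ys = count (p x) ys + crossCount p xs ys

count-++ : (q : A → Bool) (xs ys : List A) → count q (xs ++ ys) ≡ count q xs + count q ys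
count-++ q xs ys = trans (cong length (filter-++ (λ y → T? (q y)) xs ys)) (length-++ (filter (λ y → T? (q y)) xs))

count-cong : {q q′ : A → Bool} → (∀ y → q y ≡ q′ y) → (ys : List A) → count q ys ≡ count q′ ys
count-cong q≗q′ []       = refl
count-cong {q′ = q′} q≗q′ (y ∷ ys) rewrite q≗q′ y with q′ y
... | true  = cong suc (count-cong q≗q′ ys)
... | false = count-cong q≗q′ ys

count-false : (ys : List A) → count (λ _ → false) ys ≡ 0
count-false []       = refl
count-false (y ∷ ys) = count-false ys

count-complement : (q q′ : A → Bool) (ys : List A) → All (λ y → q′ y ≡ not (q y)) ys →
                   count q ys + count q′ ys ≡ length ys
count-complement q q′ []       []           = refl
count-complement q q′ (y ∷ ys) (q′y≡ ∷ rest) rewrite q′y≡ with q y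
... | true  = cong suc (count-complement q q′ ys rest)
... | false = trans (+-suc _ _) (cong suc (count-complement q q′ ys rest))

crossCount-++ˡ : (p : A → A → Bool) (xs ys zs : List A) →
                 crossCount p (xs ++ ys) zs ≡ crossCount p xs zs + crossCount p ys zs
crossCount-++ˡ p []       ys zs = refl
crossCount-++ˡ p (x ∷ xs) ys zs =
  trans (cong (count (p x) zs +_) (crossCount-++ˡ p xs ys zs)) (sym (+-assoc (count (p x) zs) _ _))

crossCount-∷ʳ : (p : A → A → Bool) (y : A) (xs ys : List A) →
                crossCount p xs (y ∷ ys) ≡ count (λ x → p x y) xs + crossCount p xs ys
crossCount-∷ʳ p y []       ys = refl
crossCount-∷ʳ p y (x ∷ xs) ys rewrite crossCount-∷ʳ p y xs ys with p x y
... | true  = cong suc (x∙yz≈y∙xz (count (p x) ys) (count (λ z → p z y) xs) (crossCount p xs ys))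
... | false = x∙yz≈y∙xz (count (p x) ys) (count (λ z → p z y) xs) (crossCount p xs ys)

crossCount-product : (p : A → A → Bool) (f g : A → Bool) → (∀ x y → p x y ≡ f x ∧ g y) →
                     (xs ys : List A) → crossCount p xs ys ≡ count f xs * count g ys
crossCount-product p f g p≡f∧g []       ys = refl
crossCount-product p f g p≡f∧g (x ∷ xs) ys rewrite count-cong (p≡f∧g x) ys with f x
... | true  = cong (count g ys +_) (crossCount-product p f g p≡f∧g xs ys)
... | false = trans (cong (_+ crossCount p xs ys) (count-false ys)) (crossCount-product p f g p≡f∧g xs ys)

crossCount-tournament : (p : A → A → Bool) (xs ys : List A) →
                        All (λ x → All (λ y → p y x ≡ not (p x y)) ys) xs →
                        crossCount p xs ys + crossCount p ys xs ≡ length xs * length ys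
crossCount-tournament p []       ys []         = crossCount-[]ʳ ys
  where crossCount-[]ʳ : ∀ ys → crossCount p ys [] ≡ 0
        crossCount-[]ʳ []       = refl
        crossCount-[]ʳ (y ∷ ys) = crossCount-[]ʳ ys
crossCount-tournament p (x ∷ xs) ys (px ∷ pxs) = begin
  count (p x) ys + crossCount p xs ys + crossCount p ys (x ∷ xs)
    ≡⟨ cong (count (p x) ys + crossCount p xs ys +_) (crossCount-∷ʳ p x ys xs) ⟩
  count (p x) ys + crossCount p xs ys + (count (λ y → p y x) ys + crossCount p ys xs)
    ≡⟨ interchange (count (p x) ys) (crossCount p xs ys) _ _ ⟩
  count (p x) ys + count (λ y → p y x) ys + (crossCount p xs ys + crossCount p ys xs)
    ≡⟨ cong₂ _+_ (count-complement (p x) (λ y → p y x) ys px) (crossCount-tournament p xs ys pxs) ⟩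
  length ys + length xs * length ys ∎
  where open ≡-Reasoning

pairCount-++ : (p : A → A → Bool) (xs ys : List A) →
               pairCount p (xs ++ ys) ≡ pairCount p xs + pairCount p ys + crossCount p xs ys
pairCount-++ p []       ys = sym (+-identityʳ (pairCount p ys))
pairCount-++ p (x ∷ xs) ys rewrite count-++ (p x) xs ys | pairCount-++ p xs ys =
  solve 5 (λ a b c d e → (a :+ b) :+ (c :+ d :+ e) := a :+ c :+ d :+ (b :+ e)) refl
    (count (p x) xs) (count (p x) ys) (pairCount p xs) (pairCount p ys) (crossCount p xs ys)

pairCount-swap : (p : A → A → Bool) (xs ys : List A) →
                 pairCount p (xs ++ ys) + crossCount p ys xs ≡ pairCount p (ys ++ xs) + crossCount p xs ys
pairCount-swap p xs ys rewrite pairCount-++ p xs ys | pairCount-++ p ys xs =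
  solve 4 (λ a b c d → a :+ b :+ c :+ d := b :+ a :+ d :+ c) refl
    (pairCount p xs) (pairCount p ys) (crossCount p xs ys) (crossCount p ys xs)

count-swap : (q : A → Bool) (xs ys zs : List A) → count q ((xs ++ ys) ++ zs) ≡ count q ((ys ++ xs) ++ zs)
count-swap q xs ys zs rewrite count-++ q (xs ++ ys) zs | count-++ q (ys ++ xs) zs
                            | count-++ q xs ys | count-++ q ys xs =
  cong (_+ count q zs) (+-comm (count q xs) (count q ys))

crossCount-swapˡ : (p : A → A → Bool) (xs ys zs : List A) →
                   crossCount p (xs ++ ys) zs ≡ crossCount p (ys ++ xs) zs
crossCount-swapˡ p xs ys zs rewrite crossCount-++ˡ p xs ys zs | crossCount-++ˡ p ys xs zs =
  +-comm (crossCount p xs zs) (crossCount p ys zs)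

pairCount-swap-++ : (p : A → A → Bool) (xs ys zs : List A) →
                    pairCount p ((xs ++ ys) ++ zs) + crossCount p ys xs
                      ≡ pairCount p ((ys ++ xs) ++ zs) + crossCount p xs ys
pairCount-swap-++ p xs ys zs = begin
  pairCount p ((xs ++ ys) ++ zs) + crossCount p ys xs
    ≡⟨ cong (_+ crossCount p ys xs) (pairCount-++ p (xs ++ ys) zs) ⟩
  pairCount p (xs ++ ys) + pairCount p zs + crossCount p (xs ++ ys) zs + crossCount p ys xs
    ≡⟨ move-last (pairCount p (xs ++ ys)) _ _ _ ⟩
  pairCount p (xs ++ ys) + crossCount p ys xs + pairCount p zs + crossCount p (xs ++ ys) zs
    ≡⟨ cong₂ (λ a b → a + pairCount p zs + b) (pairCount-swap p xs ys) (crossCount-swapˡ p xs ys zs) ⟩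
  pairCount p (ys ++ xs) + crossCount p xs ys + pairCount p zs + crossCount p (ys ++ xs) zs
    ≡⟨ move-last (pairCount p (ys ++ xs)) _ _ _ ⟨
  pairCount p (ys ++ xs) + pairCount p zs + crossCount p (ys ++ xs) zs + crossCount p xs ys
    ≡⟨ cong (_+ crossCount p xs ys) (pairCount-++ p (ys ++ xs) zs) ⟨
  pairCount p ((ys ++ xs) ++ zs) + crossCount p xs ys ∎
  where
  open ≡-Reasoning
  move-last : ∀ a b c d → a + b + c + d ≡ a + d + b + c
  move-last = solve 4 (λ a b c d → a :+ b :+ c :+ d := a :+ d :+ b :+ c) refl

pairCount-swap-∷ : (p : A → A → Bool) (r : A) (xs ys zs : List A) →
                   pairCount p (r ∷ (xs ++ ys) ++ zs) + crossCount p ys xs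
                     ≡ pairCount p (r ∷ (ys ++ xs) ++ zs) + crossCount p xs ys
pairCount-swap-∷ p r xs ys zs = begin
  count (p r) ((xs ++ ys) ++ zs) + pairCount p ((xs ++ ys) ++ zs) + crossCount p ys xs
    ≡⟨ +-assoc (count (p r) ((xs ++ ys) ++ zs)) _ _ ⟩
  count (p r) ((xs ++ ys) ++ zs) + (pairCount p ((xs ++ ys) ++ zs) + crossCount p ys xs)
    ≡⟨ cong₂ _+_ (count-swap (p r) xs ys zs) (pairCount-swap-++ p xs ys zs) ⟩
  count (p r) ((ys ++ xs) ++ zs) + (pairCount p ((ys ++ xs) ++ zs) + crossCount p xs ys)
    ≡⟨ +-assoc (count (p r) ((ys ++ xs) ++ zs)) _ _ ⟨
  count (p r) ((ys ++ xs) ++ zs) + pairCount p ((ys ++ xs) ++ zs) + crossCount p xs ys ∎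
  where open ≡-Reasoning

isWhite isBlack isClose isLabel : Sym → Bool
isWhite (wlab _) = true
isWhite _        = false
isBlack (blab _) = true
isBlack _        = false
isClose close    = true
isClose _        = false
isLabel close    = false
isLabel _        = true

isBW≡isBlack∧isWhite : ∀ x y → isBW x y ≡ isBlack x ∧ isWhite y
isBW≡isBlack∧isWhite (wlab _) y        = refl
isBW≡isBlack∧isWhite close    y        = refl
isBW≡isBlack∧isWhite (blab _) (wlab _) = refl
isBW≡isBlack∧isWhite (blab _) (blab _) = refl
isBW≡isBlack∧isWhite (blab _) close    = refl

isCL≡isClose∧isLabel : ∀ x y → isCL x y ≡ isClose x ∧ isLabel y
isCL≡isClose∧isLabel (wlab _) y        = refl
isCL≡isClose∧isLabel (blab _) y        = refl
isCL≡isClose∧isLabel close    (wlab _) = refl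
isCL≡isClose∧isLabel close    (blab _) = refl
isCL≡isClose∧isLabel close    close    = refl

length-whiteLabels : (w : List Sym) → length (whiteLabels w) ≡ count isWhite w
length-whiteLabels []           = refl
length-whiteLabels (wlab _ ∷ w) = cong suc (length-whiteLabels w)
length-whiteLabels (blab _ ∷ w) = length-whiteLabels w
length-whiteLabels (close  ∷ w) = length-whiteLabels w

length-blackLabels : (w : List Sym) → length (blackLabels w) ≡ count isBlack w
length-blackLabels []           = refl
length-blackLabels (wlab _ ∷ w) = length-blackLabels w
length-blackLabels (blab _ ∷ w) = cong suc (length-blackLabels w)
length-blackLabels (close  ∷ w) = length-blackLabels w

count-isLabel : (w : List Sym) → count isLabel w ≡ count isWhite w + count isBlack w
count-isLabel []           = refl
count-isLabel (wlab _ ∷ w) = cong suc (count-isLabel w)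
count-isLabel (blab _ ∷ w) = trans (cong suc (count-isLabel w)) (sym (+-suc _ _))
count-isLabel (close  ∷ w) = count-isLabel w

whiteLabels-++ : (xs ys : List Sym) → whiteLabels (xs ++ ys) ≡ whiteLabels xs ++ whiteLabels ys
whiteLabels-++ = mapMaybe-++ _

blackLabels-++ : (xs ys : List Sym) → blackLabels (xs ++ ys) ≡ blackLabels xs ++ blackLabels ys
blackLabels-++ = mapMaybe-++ _

Balanced : List Sym → Set
Balanced w = count isClose w ≡ count isLabel w

close-balanced : (w : List Sym) → Balanced w → count isClose (w ++ [ close ]) ≡ suc (count isLabel (w ++ [ close ]))
close-balanced w balanced = begin
  count isClose (w ++ [ close ])   ≡⟨ count-++ isClose w [ close ] ⟩
  count isClose w + 1              ≡⟨ +-comm _ 1 ⟩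
  suc (count isClose w)            ≡⟨ cong suc balanced ⟩
  suc (count isLabel w)            ≡⟨ cong suc (+-identityʳ _) ⟨
  suc (count isLabel w + 0)        ≡⟨ cong suc (count-++ isLabel w [ close ]) ⟨
  suc (count isLabel (w ++ [ close ])) ∎
  where open ≡-Reasoning

mutual
  code-balanced : (c : Colour) (t : Tree) → Balanced (code c t)
  code-balanced white (node k ts) = close-balanced (codes black ts) (codes-balanced black ts)
  code-balanced black (node k ts) = close-balanced (codes white ts) (codes-balanced white ts)

  codes-balanced : (c : Colour) (ts : List Tree) → Balanced (codes c ts)
  codes-balanced c []       = refl
  codes-balanced c (t ∷ ts) rewrite count-++ isClose (code c t) (codes c ts)
                                  | count-++ isLabel (code c t) (codes c ts) =
    cong₂ _+_ (code-balanced c t) (codes-balanced c ts)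

codes-++ : (c : Colour) (ts us : List Tree) → codes c (ts ++ us) ≡ codes c ts ++ codes c us
codes-++ c []       us = refl
codes-++ c (t ∷ ts) us = trans (cong (code c t ++_) (codes-++ c ts us)) (sym (++-assoc (code c t) _ _))

rootWord : ℕ → List Sym → List Sym → List Sym
rootWord r xs ys = wlab r ∷ (xs ++ ys) ++ [ close ]

cT-++ : (r : ℕ) (ts us : List Tree) → cT (node r (ts ++ us)) ≡ rootWord r (codes black ts) (codes black us)
cT-++ r ts us = cong (λ w → wlab r ∷ w ++ [ close ]) (codes-++ black ts us)

whiteLabels-rootWord : (r : ℕ) (xs ys : List Sym) →
                       whiteLabels (rootWord r xs ys) ≡ r ∷ (whiteLabels xs ++ whiteLabels ys) ++ []
whiteLabels-rootWord r xs ys =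
  cong (r ∷_) (trans (whiteLabels-++ (xs ++ ys) [ close ]) (cong (_++ []) (whiteLabels-++ xs ys)))

blackLabels-rootWord : (r : ℕ) (xs ys : List Sym) →
                       blackLabels (rootWord r xs ys) ≡ (blackLabels xs ++ blackLabels ys) ++ []
blackLabels-rootWord r xs ys =
  trans (blackLabels-++ (xs ++ ys) [ close ]) (cong (_++ []) (blackLabels-++ xs ys))

count-isLabel-rootWord : (r : ℕ) (xs ys : List Sym) →
                         count isLabel (rootWord r xs ys) ≡ suc (count isLabel xs + count isLabel ys)
count-isLabel-rootWord r xs ys = cong suc (begin
  count isLabel ((xs ++ ys) ++ [ close ])   ≡⟨ count-++ isLabel (xs ++ ys) [ close ] ⟩
  count isLabel (xs ++ ys) + 0              ≡⟨ +-identityʳ _ ⟩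
  count isLabel (xs ++ ys)                  ≡⟨ count-++ isLabel xs ys ⟩
  count isLabel xs + count isLabel ys ∎)
  where open ≡-Reasoning

<ᵇ-flip : {x y : ℕ} → x ≢ y → (x <ᵇ y) ≡ not (y <ᵇ x)
<ᵇ-flip {x} {y} x≢y with x <ᵇ y in x<ᵇy | y <ᵇ x in y<ᵇx
... | true  | true  = ⊥-elim (<-asym (<ᵇ⇒< x y (subst T (sym x<ᵇy) _)) (<ᵇ⇒< y x (subst T (sym y<ᵇx) _)))
... | true  | false = refl
... | false | true  = refl
... | false | false = ⊥-elim (x≢y (≤-antisym (≮⇒≥ (λ y<x → subst T y<ᵇx (<⇒<ᵇ y<x)))
                                              (≮⇒≥ (λ x<y → subst T x<ᵇy (<⇒<ᵇ x<y)))))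

inverted : ℕ → ℕ → Bool
inverted k l = l <ᵇ k

_#_ : List ℕ → List ℕ → Set
xs # ys = All (λ x → All (x ≢_) ys) xs

crossCount-inverted : (xs ys : List ℕ) → xs # ys →
                      crossCount inverted xs ys + crossCount inverted ys xs ≡ length xs * length ys
crossCount-inverted xs ys xs#ys =
  crossCount-tournament inverted xs ys (All.map (All.map <ᵇ-flip) xs#ys)

+-interchange₃ : ∀ a b c x y z → a + b + c + (x + y + z) ≡ (a + x) + (b + y) + (c + z)
+-interchange₃ = solve 6 (λ a b c x y z → a :+ b :+ c :+ (x :+ y :+ z) := (a :+ x) :+ (b :+ y) :+ (c :+ z)) refl

abc : List Sym → ℕ
abc w = inversions (whiteLabels w) + inversions (blackLabels w) + pairCount isBW w

crossings : List Sym → List Sym → ℕ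
crossings xs ys = crossCount inverted (whiteLabels xs) (whiteLabels ys)
                + crossCount inverted (blackLabels xs) (blackLabels ys)
                + crossCount isBW xs ys

abc-rootWord : (r : ℕ) (xs ys : List Sym) →
               abc (rootWord r xs ys)
                 ≡ pairCount inverted (r ∷ (whiteLabels xs ++ whiteLabels ys) ++ [])
                   + pairCount inverted ((blackLabels xs ++ blackLabels ys) ++ [])
                   + pairCount isBW (rootWord r xs ys)
abc-rootWord r xs ys =
  cong₂ (λ W B → inversions W + inversions B + pairCount isBW (rootWord r xs ys))
        (whiteLabels-rootWord r xs ys) (blackLabels-rootWord r xs ys)

abc-swap : (r : ℕ) (xs ys : List Sym) →
           abc (rootWord r ys xs) + crossings xs ys ≡ abc (rootWord r xs ys) + crossings ys xs
abc-swap r xs ys = begin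
  abc (rootWord r ys xs) + (α + β + γ)  ≡⟨ cong (_+ (α + β + γ)) (abc-rootWord r ys xs) ⟩
  a′ + b′ + c′ + (α + β + γ)            ≡⟨ +-interchange₃ a′ b′ c′ α β γ ⟩
  (a′ + α) + (b′ + β) + (c′ + γ)        ≡⟨ cong₂ _+_ (cong₂ _+_ a-swap b-swap) c-swap ⟩
  (a + α′) + (b + β′) + (c + γ′)        ≡⟨ +-interchange₃ a b c α′ β′ γ′ ⟨
  a + b + c + (α′ + β′ + γ′)            ≡⟨ cong (_+ (α′ + β′ + γ′)) (abc-rootWord r xs ys) ⟨
  abc (rootWord r xs ys) + (α′ + β′ + γ′) ∎
  where
  open ≡-Reasoning
  Wx = whiteLabels xs
  Wy = whiteLabels ys
  Bx = blackLabels xs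
  By = blackLabels ys
  a  = pairCount inverted (r ∷ (Wx ++ Wy) ++ [])
  a′ = pairCount inverted (r ∷ (Wy ++ Wx) ++ [])
  b  = pairCount inverted ((Bx ++ By) ++ [])
  b′ = pairCount inverted ((By ++ Bx) ++ [])
  c  = pairCount isBW (rootWord r xs ys)
  c′ = pairCount isBW (rootWord r ys xs)
  α  = crossCount inverted Wx Wy
  α′ = crossCount inverted Wy Wx
  β  = crossCount inverted Bx By
  β′ = crossCount inverted By Bx
  γ  = crossCount isBW xs ys
  γ′ = crossCount isBW ys xs
  a-swap : a′ + α ≡ a + α′
  a-swap = pairCount-swap-∷ inverted r Wy Wx []
  b-swap : b′ + β ≡ b + β′
  b-swap = pairCount-swap-++ inverted By Bx []
  c-swap : c′ + γ ≡ c + γ′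
  c-swap = pairCount-swap-∷ isBW (wlab r) ys xs [ close ]

crossings-sum : (xs ys : List Sym) → whiteLabels xs # whiteLabels ys → blackLabels xs # blackLabels ys →
                crossings xs ys + crossings ys xs ≡ count isLabel xs * count isLabel ys
crossings-sum xs ys Wx#Wy Bx#By = begin
  α + β + γ + (α′ + β′ + γ′)
    ≡⟨ +-interchange₃ α β γ α′ β′ γ′ ⟩
  (α + α′) + (β + β′) + (γ + γ′)
    ≡⟨ cong₂ (λ u v → u + v + (γ + γ′)) (crossCount-inverted Wx Wy Wx#Wy) (crossCount-inverted Bx By Bx#By) ⟩
  length Wx * length Wy + length Bx * length By + (γ + γ′)
    ≡⟨ cong₂ (λ u v → u + v + (γ + γ′))
             (cong₂ _*_ (length-whiteLabels xs) (length-whiteLabels ys))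
             (cong₂ _*_ (length-blackLabels xs) (length-blackLabels ys)) ⟩
  wx * wy + bx * by + (γ + γ′)
    ≡⟨ cong (wx * wy + bx * by +_) (cong₂ _+_ (crossCount-BW xs ys) (crossCount-BW ys xs)) ⟩
  wx * wy + bx * by + (bx * wy + by * wx)
    ≡⟨ solve 4 (λ a b c d → a :* c :+ b :* d :+ (b :* c :+ d :* a) := (a :+ b) :* (c :+ d)) refl wx bx wy by ⟩
  (wx + bx) * (wy + by)
    ≡⟨ cong₂ _*_ (count-isLabel xs) (count-isLabel ys) ⟨
  count isLabel xs * count isLabel ys ∎
  where
  open ≡-Reasoning
  Wx = whiteLabels xs
  Wy = whiteLabels ys
  Bx = blackLabels xs
  By = blackLabels ys
  wx = count isWhite xs
  wy = count isWhite ys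
  bx = count isBlack xs
  by = count isBlack ys
  α  = crossCount inverted Wx Wy
  α′ = crossCount inverted Wy Wx
  β  = crossCount inverted Bx By
  β′ = crossCount inverted By Bx
  γ  = crossCount isBW xs ys
  γ′ = crossCount isBW ys xs
  crossCount-BW : ∀ xs ys → crossCount isBW xs ys ≡ count isBlack xs * count isWhite ys
  crossCount-BW = crossCount-product isBW isBlack isWhite isBW≡isBlack∧isWhite

pairCount-isCL-swap : (r : ℕ) (xs ys : List Sym) → Balanced xs → Balanced ys →
                      pairCount isCL (rootWord r ys xs) ≡ pairCount isCL (rootWord r xs ys)
pairCount-isCL-swap r xs ys balanced-xs balanced-ys =
  +-cancelʳ-≡ (crossCount isCL xs ys) _ _
    (trans (pairCount-swap-∷ isCL (wlab r) ys xs [ close ]) (cong (pairCount isCL (rootWord r xs ys) +_) symmetric))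
  where
  symmetric : crossCount isCL ys xs ≡ crossCount isCL xs ys
  symmetric = begin
    crossCount isCL ys xs                ≡⟨ crossCount-CL ys xs ⟩
    count isClose ys * count isLabel xs  ≡⟨ cong₂ _*_ balanced-ys (sym balanced-xs) ⟩
    count isLabel ys * count isClose xs  ≡⟨ *-comm (count isLabel ys) (count isClose xs) ⟩
    count isClose xs * count isLabel ys  ≡⟨ crossCount-CL xs ys ⟨
    crossCount isCL xs ys                ∎
    where
    open ≡-Reasoning
    crossCount-CL : ∀ xs ys → crossCount isCL xs ys ≡ count isClose xs * count isLabel ys
    crossCount-CL = crossCount-product isCL isClose isLabel isCL≡isClose∧isLabel

even⊎odd : ∀ k → 2 ∣ k ⊎ 2 ∣ suc k
even⊎odd zero    = inj₁ (divides 0 refl)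
even⊎odd (suc k) with even⊎odd k
... | inj₁ (divides q k≡q*2) = inj₂ (divides (suc q) (cong (suc ∘ suc) k≡q*2))
... | inj₂ 2∣1+k             = inj₁ 2∣1+k

odd-sum⇒even-product : ∀ k l → 2 ∣ suc (k + l) → 2 ∣ k * l
odd-sum⇒even-product k l 2∣1+k+l with even⊎odd k
... | inj₁ 2∣k   = ∣m⇒∣m*n l 2∣k
... | inj₂ 2∣1+k = ∣n⇒∣m*n k (∣m+n∣m⇒∣n 2∣1+k+l 2∣1+k)

%2-exchange : ∀ x y u v z → x + u ≡ y + v → 2 ∣ u + v → (x + z) % 2 ≡ (y + z) % 2
%2-exchange x y u v z x+u≡y+v (divides h u+v≡h*2) = begin
  (x + z) % 2                ≡⟨ [m+kn]%n≡m%n (x + z) h 2 ⟨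
  (x + z + h * 2) % 2        ≡⟨ cong (λ s → (x + z + s) % 2) u+v≡h*2 ⟨
  (x + z + (u + v)) % 2      ≡⟨ cong (_% 2) (solve 4 (λ x z u v → x :+ z :+ (u :+ v) := x :+ u :+ z :+ v) refl x z u v) ⟩
  (x + u + z + v) % 2        ≡⟨ cong (λ s → (s + z + v) % 2) x+u≡y+v ⟩
  (y + v + z + v) % 2        ≡⟨ cong (_% 2) (solve 3 (λ y z v → y :+ v :+ z :+ v := y :+ z :+ v :* con 2) refl y z v) ⟩
  (y + z + v * 2) % 2        ≡⟨ [m+kn]%n≡m%n (y + z) v 2 ⟩
  (y + z) % 2                ∎
  where open ≡-Reasoning

unique-↭-upTo : {xs : List ℕ} (n : ℕ) → xs ↭ upTo n → Unique xs
unique-↭-upTo n xs↭upTo = PermutationSetoid.Unique-resp-↭ (setoid ℕ) (↭⇒↭ₛ (↭-sym xs↭upTo)) (upTo⁺ n)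

AllPairs-++⇒All-across : {R : A → A → Set} (xs ys : List A) → AllPairs R (xs ++ ys) → All (λ x → All (R x) ys) xs
AllPairs-++⇒All-across []       ys _          = []
AllPairs-++⇒All-across (x ∷ xs) ys (Rx ∷ Rxs) = ++⁻ʳ xs Rx ∷ AllPairs-++⇒All-across xs ys Rxs

whiteLabels-separated : (n r : ℕ) (xs ys : List Sym) → whiteLabels (rootWord r xs ys) ↭ upTo n →
                        whiteLabels xs # whiteLabels ys
whiteLabels-separated n r xs ys W↭upTo
  with subst Unique (whiteLabels-rootWord r xs ys) (unique-↭-upTo n W↭upTo)
... | _ ∷ unique = AllPairs-++⇒All-across (whiteLabels xs) (whiteLabels ys)
                     (subst Unique (++-identityʳ _) unique)

blackLabels-separated : (m r : ℕ) (xs ys : List Sym) → blackLabels (rootWord r xs ys) ↭ upTo m →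
                        blackLabels xs # blackLabels ys
blackLabels-separated m r xs ys B↭upTo =
  AllPairs-++⇒All-across (blackLabels xs) (blackLabels ys)
    (subst Unique (trans (blackLabels-rootWord r xs ys) (++-identityʳ _)) (unique-↭-upTo m B↭upTo))

labelCount-rootWord : (n m r : ℕ) (xs ys : List Sym) →
                      whiteLabels (rootWord r xs ys) ↭ upTo n → blackLabels (rootWord r xs ys) ↭ upTo m →
                      n + m ≡ suc (count isLabel xs + count isLabel ys)
labelCount-rootWord n m r xs ys W↭upTo B↭upTo = begin
  n + m                                  ≡⟨ cong₂ _+_ (length-upTo n) (length-upTo m) ⟨
  length (upTo n) + length (upTo m)      ≡⟨ cong₂ _+_ (↭-length W↭upTo) (↭-length B↭upTo) ⟨
  length (whiteLabels w) + length (blackLabels w)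
    ≡⟨ cong₂ _+_ (length-whiteLabels w) (length-blackLabels w) ⟩
  count isWhite w + count isBlack w      ≡⟨ count-isLabel w ⟨
  count isLabel w                        ≡⟨ count-isLabel-rootWord r xs ys ⟩
  suc (count isLabel xs + count isLabel ys) ∎
  where
  open ≡-Reasoning
  w = rootWord r xs ys

wordInvariant : ℕ → ℕ → List Sym → ℕ
wordInvariant n m w = (abc w + (pairCount isCL w + ∣ n - m ∣ / 2) / 2) % 2

wordInvariant-swap : (n m : ℕ) → 2 ∣ n + m → (r : ℕ) (xs ys : List Sym) → Balanced xs → Balanced ys →
                     whiteLabels (rootWord r xs ys) ↭ upTo n → blackLabels (rootWord r xs ys) ↭ upTo m →
                     wordInvariant n m (rootWord r ys xs) ≡ wordInvariant n m (rootWord r xs ys)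
wordInvariant-swap n m 2∣n+m r xs ys balanced-xs balanced-ys W↭upTo B↭upTo = begin
  (abc (rootWord r ys xs) + (pairCount isCL (rootWord r ys xs) + e) / 2) % 2
    ≡⟨ cong (λ d → (abc (rootWord r ys xs) + (d + e) / 2) % 2) (pairCount-isCL-swap r xs ys balanced-xs balanced-ys) ⟩
  (abc (rootWord r ys xs) + (pairCount isCL (rootWord r xs ys) + e) / 2) % 2
    ≡⟨ %2-exchange (abc (rootWord r ys xs)) (abc (rootWord r xs ys)) (crossings xs ys) (crossings ys xs)
                    ((pairCount isCL (rootWord r xs ys) + e) / 2) (abc-swap r xs ys) crossings-even ⟩
  (abc (rootWord r xs ys) + (pairCount isCL (rootWord r xs ys) + e) / 2) % 2 ∎
  where
  open ≡-Reasoning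
  e = ∣ n - m ∣ / 2
  crossings-even : 2 ∣ crossings xs ys + crossings ys xs
  crossings-even =
    subst (2 ∣_)
      (sym (crossings-sum xs ys (whiteLabels-separated n r xs ys W↭upTo) (blackLabels-separated m r xs ys B↭upTo)))
      (odd-sum⇒even-product (count isLabel xs) (count isLabel ys)
        (subst (2 ∣_) (labelCount-rootWord n m r xs ys W↭upTo B↭upTo) 2∣n+m))

invariant-swap : (n m : ℕ) → 2 ∣ n + m → (r : ℕ) (ts us : List Tree) →
                 whiteLabels (cT (node r (ts ++ us))) ↭ upTo n → blackLabels (cT (node r (ts ++ us))) ↭ upTo m →
                 invariant n m (node r (us ++ ts)) ≡ invariant n m (node r (ts ++ us))
invariant-swap n m 2∣n+m r ts us W↭upTo B↭upTo = begin
  wordInvariant n m (cT (node r (us ++ ts)))  ≡⟨ cong (wordInvariant n m) (cT-++ r us ts) ⟩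
  wordInvariant n m (rootWord r ys xs)        ≡⟨ wordInvariant-swap n m 2∣n+m r xs ys
                                                   (codes-balanced black ts) (codes-balanced black us)
                                                   (subst (λ w → whiteLabels w ↭ upTo n) (cT-++ r ts us) W↭upTo)
                                                   (subst (λ w → blackLabels w ↭ upTo m) (cT-++ r ts us) B↭upTo) ⟩
  wordInvariant n m (rootWord r xs ys)        ≡⟨ cong (wordInvariant n m) (cT-++ r ts us) ⟨
  wordInvariant n m (cT (node r (ts ++ us)))  ∎
  where
  open ≡-Reasoning
  xs = codes black ts
  ys = codes black us

theorem3p1 : (n m : ℕ) → 2 ∣ n + m → (t : Tree)
    → whiteLabels (cT t) ↭ upTo n
    → blackLabels (cT t) ↭ upTo m
    → (k : ℕ) → invariant n m (rotateRoot k t) ≡ invariant n m t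
theorem3p1 n m 2∣n+m (node r ts) W↭upTo B↭upTo k = begin
  invariant n m (node r (drop k ts ++ take k ts))
    ≡⟨ invariant-swap n m 2∣n+m r (take k ts) (drop k ts)
         (subst (λ us → whiteLabels (cT (node r us)) ↭ upTo n) (sym split) W↭upTo)
         (subst (λ us → blackLabels (cT (node r us)) ↭ upTo m) (sym split) B↭upTo) ⟩
  invariant n m (node r (take k ts ++ drop k ts))
    ≡⟨ cong (invariant n m ∘ node r) split ⟩
  invariant n m (node r ts) ∎
  where
  open ≡-Reasoning
  split = take++drop≡id k ts
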